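{- For any natural numbers $s$, $k>1$ and $n\ge k$, one has $\mathcal F_{s,k}(n)=(-1)^k\,\mathcal F_{n-s,k}(n)$.
   Context: For integers $s$ and natural $k$, the Moser polynomial is $\mathcal F_{s,k}(x)=\sum_{j=1}^{s}(-1)^{j-1}j^{k-1}\binom{x}{s-j}$, where $\binom{x}{m}=x(x-1)\cdots(x-m+1)/m!$ for $m\ge0$ and $\binom xm=0$ for $m<0$; in particular $\mathcal F_{s,k}=0$ when $s\le0$ (empty sum). -}

module Defs where

open import Data.Nat as ℕ using (ℕ; zero; suc; _∸_)
open import Data.Nat.Combinatorics using (_C_)
open import Data.Integer as ℤ using (ℤ; +_; -[1+_]; _+_; _*_; -_; 0ℤ)

sgn : ℕ → ℤ
sgn zero = + 1
sgn (suc m) = - sgn m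

-- binomial (x choose m) evaluated at a natural number x: the polynomial
-- x(x-1)...(x-m+1)/m! at natural x equals the usual nCk (0 when m > x).

sumFrom1 : ℕ → (ℕ → ℤ) → ℤ
sumFrom1 zero f = 0ℤ
sumFrom1 (suc t) f = sumFrom1 t f + f (suc t)

Fℕ : ℕ → ℕ → ℕ → ℤ
Fℕ s k x = sumFrom1 s (λ j → sgn (j ∸ 1) * (+ (j ℕ.^ (k ∸ 1))) * (+ (x C (s ∸ j))))

-- Moser polynomial for integer s: empty sum (= 0) when s ≤ 0
F : ℤ → ℕ → ℕ → ℤ
F (+ s) k x = Fℕ s k x
F -[1+ s ] k x = 0ℤ

module Submission where

-- Write E_k(s, n) = F_{s,k}(n) − (−1)^k F_{n−s,k}(n) for the defect of the
-- reflection identity; the theorem says E_k(s, n) = 0 whenever 2 ≤ k ≤ n.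
--
-- Everything rests on two recurrences, proved for the weighted binomial sums
-- Σ_{j=1}^{s} w(j) C(x, s−j) with an arbitrary weight w (the Moser polynomial
-- is the weight w(j) = (−1)^{j−1} j^{k−1}):
--   Pascal:  F_{s,k}(x+1)   = F_{s,k}(x) + F_{s−1,k}(x),
--   raise:   F_{s,k+1}(x+1) = s F_{s,k}(x+1) − (x+1) F_{s−1,k}(x),
-- the latter because multiplying the weight by j and using the absorption
-- identity (d+1) C(x+1, d+1) = (x+1) C(x, d) produces exactly these two sums.
-- Both recurrences pass to the defect, since n − s moves compatibly with s.
-- The Pascal recurrence and the value at n = 1 give E_1(s, n) = C(n, s) for
-- n ≥ 1; the raise recurrence and binomial absorption then give E_2 = 0 for
-- n ≥ 2, and induction on k with the raise recurrence gives E_k = 0.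

open import Defs
open import Data.Nat using (ℕ; _≤_; _<_)
open import Data.Integer using (ℤ; +_; _-_; _*_)
open import Relation.Binary.PropositionalEquality using (_≡_)

open import Data.Nat as ℕ using (zero; suc; _∸_; s≤s; z≤n)
import Data.Nat.Properties as ℕP
open import Data.Nat.Combinatorics using (_C_; nCk+nC[k+1]≡[n+1]C[k+1]; nC1≡n; k>n⇒nCk≡0)
import Data.Nat.Tactic.RingSolver as ℕSolver
open import Data.Integer as ℤ using (-[1+_]; _+_; -_; 0ℤ)
import Data.Integer.Properties as ℤP
open import Data.Integer.Tactic.RingSolver using (solve-∀)
open import Relation.Binary.PropositionalEquality using (refl; sym; trans; cong; cong₂)
open Relation.Binary.PropositionalEquality.≡-Reasoning

sum-cong : ∀ t {f g : ℕ → ℤ} → (∀ j → 1 ≤ j → j ≤ t → f j ≡ g j) →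
           sumFrom1 t f ≡ sumFrom1 t g
sum-cong zero    f≡g = refl
sum-cong (suc t) f≡g =
  cong₂ _+_ (sum-cong t (λ j 1≤j j≤t → f≡g j 1≤j (ℕP.m≤n⇒m≤1+n j≤t)))
            (f≡g (suc t) (s≤s z≤n) ℕP.≤-refl)

sum-+ : ∀ t (f g : ℕ → ℤ) →
        sumFrom1 t (λ j → f j + g j) ≡ sumFrom1 t f + sumFrom1 t g
sum-+ zero    f g = refl
sum-+ (suc t) f g =
  trans (cong (_+ (f (suc t) + g (suc t))) (sum-+ t f g))
        (interchange (sumFrom1 t f) (sumFrom1 t g) (f (suc t)) (g (suc t)))
  where
  interchange : ∀ (a b c d : ℤ) → (a + b) + (c + d) ≡ (a + c) + (b + d)
  interchange = solve-∀

sum-* : ∀ t (c : ℤ) (f : ℕ → ℤ) → sumFrom1 t (λ j → c * f j) ≡ c * sumFrom1 t f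
sum-* zero    c f = sym (ℤP.*-zeroʳ c)
sum-* (suc t) c f = trans (cong (_+ c * f (suc t)) (sum-* t c f))
                          (sym (ℤP.*-distribˡ-+ c (sumFrom1 t f) (f (suc t))))

sum-zero : ∀ t → sumFrom1 t (λ _ → 0ℤ) ≡ 0ℤ
sum-zero zero    = refl
sum-zero (suc t) = cong (_+ 0ℤ) (sum-zero t)

suc-∸ : ∀ {j s} → j ≤ s → suc s ∸ j ≡ suc (s ∸ j)
suc-∸ = ℕP.+-∸-assoc 1

C-last : ∀ x s → x C (suc s ∸ suc s) ≡ 1
C-last x s rewrite ℕP.n∸n≡0 s = refl

pascal : ∀ x d → suc x C suc d ≡ x C suc d ℕ.+ x C d
pascal x d = trans (sym (nCk+nC[k+1]≡[n+1]C[k+1] x d)) (ℕP.+-comm (x C d) (x C suc d))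

absorption : ∀ x d → suc d ℕ.* (suc x C suc d) ≡ suc x ℕ.* (x C d)
absorption x zero = trans (ℕP.*-identityˡ _) (trans (nC1≡n (suc x)) (sym (ℕP.*-identityʳ (suc x))))
absorption zero (suc d) =
  trans (cong (suc (suc d) ℕ.*_) (k>n⇒nCk≡0 {1} {suc (suc d)} (s≤s (s≤s z≤n))))
        (ℕP.*-zeroʳ (suc (suc d)))
absorption (suc x) (suc d) = begin
  suc (suc d) ℕ.* (suc (suc x) C suc (suc d))
    ≡⟨ cong (suc (suc d) ℕ.*_) (pascal (suc x) (suc d)) ⟩
  suc (suc d) ℕ.* (b ℕ.+ a)
    ≡⟨ expand d a b ⟩
  suc (suc d) ℕ.* b ℕ.+ suc d ℕ.* a ℕ.+ a
    ≡⟨ cong₂ (λ p q → p ℕ.+ q ℕ.+ a) (absorption x (suc d)) (absorption x d) ⟩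
  suc x ℕ.* (x C suc d) ℕ.+ suc x ℕ.* (x C d) ℕ.+ a
    ≡⟨ cong (ℕ._+ a) (sym (ℕP.*-distribˡ-+ (suc x) (x C suc d) (x C d))) ⟩
  suc x ℕ.* (x C suc d ℕ.+ x C d) ℕ.+ a
    ≡⟨ cong (λ c → suc x ℕ.* c ℕ.+ a) (sym (pascal x d)) ⟩
  suc x ℕ.* a ℕ.+ a
    ≡⟨ ℕP.+-comm (suc x ℕ.* a) a ⟩
  suc (suc x) ℕ.* a ∎
  where
  a = suc x C suc d
  b = suc x C suc (suc d)
  expand : ∀ d a b → suc (suc d) ℕ.* (b ℕ.+ a) ≡ suc (suc d) ℕ.* b ℕ.+ suc d ℕ.* a ℕ.+ a
  expand = ℕSolver.solve-∀

absorptionℤ : ∀ x d → + suc d * + (suc x C suc d) ≡ + suc x * + (x C d)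
absorptionℤ x d = trans (sym (ℤP.pos-* (suc d) (suc x C suc d)))
                        (trans (cong +_ (absorption x d)) (ℤP.pos-* (suc x) (x C d)))

-- C(n, s) for an integer lower index, zero for s < 0; this is the value of
-- the defect E_1.

binomℤ : ℕ → ℤ → ℤ
binomℤ n (+ s)    = + (n C s)
binomℤ n -[1+ _ ] = 0ℤ

binomℤ-pascal : ∀ n s → binomℤ (suc n) s ≡ binomℤ n s + binomℤ n (s - + 1)
binomℤ-pascal n (+ zero)    = refl
binomℤ-pascal n (+ suc s)   = trans (cong +_ (pascal n s)) (ℤP.pos-+ (n C suc s) (n C s))
binomℤ-pascal n -[1+ s ]    = refl

binomℤ-absorption : ∀ n s → s * binomℤ (suc n) s ≡ + suc n * binomℤ n (s - + 1)
binomℤ-absorption n (+ zero)  = sym (ℤP.*-zeroʳ (+ suc n))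
binomℤ-absorption n (+ suc s) = absorptionℤ n s
binomℤ-absorption n -[1+ s ]  = trans (ℤP.*-zeroʳ -[1+ s ]) (sym (ℤP.*-zeroʳ (+ suc n)))

-- Weighted binomial sums Σ_{j=1}^{s} w(j) C(x, s−j).  The Moser polynomial
-- F_{s,k}(x) is definitionally the sum with weight moserWeight k.

binomialSum : (ℕ → ℤ) → ℕ → ℕ → ℤ
binomialSum w s x = sumFrom1 s (λ j → w j * + (x C (s ∸ j)))

moserWeight : ℕ → ℕ → ℤ
moserWeight k j = sgn (j ∸ 1) * + (j ℕ.^ (k ∸ 1))

-- At x = 0 only the term j = s survives.
binomialSum-at-0 : ∀ w s → binomialSum w (suc s) 0 ≡ w (suc s)
binomialSum-at-0 w s = begin
  sumFrom1 s (λ j → w j * + (0 C (suc s ∸ j))) + w (suc s) * + (0 C (suc s ∸ suc s))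
    ≡⟨ cong₂ _+_ (trans (sum-cong s vanish) (sum-zero s))
                 (cong (λ c → w (suc s) * + c) (C-last 0 s)) ⟩
  0ℤ + w (suc s) * + 1
    ≡⟨ trans (ℤP.+-identityˡ _) (ℤP.*-identityʳ (w (suc s))) ⟩
  w (suc s) ∎
  where
  vanish : ∀ j → 1 ≤ j → j ≤ s → w j * + (0 C (suc s ∸ j)) ≡ 0ℤ
  vanish j _ j≤s rewrite suc-∸ j≤s = ℤP.*-zeroʳ (w j)

-- Pascal recurrence, termwise from C(x+1, d+1) = C(x, d+1) + C(x, d).
binomialSum-pascal : ∀ w s x →
  binomialSum w (suc s) (suc x) ≡ binomialSum w (suc s) x + binomialSum w s x
binomialSum-pascal w s x = begin
  sumFrom1 s term + w (suc s) * + (suc x C (suc s ∸ suc s))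
    ≡⟨ cong₂ _+_ (sum-cong s split)
                 (cong (λ c → w (suc s) * + c) (trans (C-last (suc x) s) (sym (C-last x s)))) ⟩
  sumFrom1 s (λ j → upper j + lower j) + upper (suc s)
    ≡⟨ cong (_+ upper (suc s)) (sum-+ s upper lower) ⟩
  (sumFrom1 s upper + sumFrom1 s lower) + upper (suc s)
    ≡⟨ swap (sumFrom1 s upper) (sumFrom1 s lower) (upper (suc s)) ⟩
  (sumFrom1 s upper + upper (suc s)) + sumFrom1 s lower ∎
  where
  term upper lower : ℕ → ℤ
  term  j = w j * + (suc x C (suc s ∸ j))
  upper j = w j * + (x C (suc s ∸ j))
  lower j = w j * + (x C (s ∸ j))
  split : ∀ j → 1 ≤ j → j ≤ s → term j ≡ upper j + lower j
  split j _ j≤s rewrite suc-∸ j≤s =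
    trans (cong (w j *_) (trans (cong +_ (pascal x (s ∸ j)))
                               (ℤP.pos-+ (x C suc (s ∸ j)) (x C (s ∸ j)))))
          (ℤP.*-distribˡ-+ (w j) (+ (x C suc (s ∸ j))) (+ (x C (s ∸ j))))
  swap : ∀ (a b c : ℤ) → (a + b) + c ≡ (a + c) + b
  swap = solve-∀

-- Raise recurrence: multiplying the weight by j.  With j + (d+1) = s+1,
-- j C(x+1, d+1) = (s+1) C(x+1, d+1) − (x+1) C(x, d) by absorption.
binomialSum-raise : ∀ {u v : ℕ → ℤ} → (∀ j → v j ≡ + j * u j) → ∀ s x →
  binomialSum v (suc s) (suc x) ≡
    + suc s * binomialSum u (suc s) (suc x) - + suc x * binomialSum u s x
binomialSum-raise {u} {v} v≡j*u s x = begin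
  sumFrom1 s term + term (suc s)
    ≡⟨ cong₂ _+_ (sum-cong s split) lastTerm ⟩
  sumFrom1 s (λ j → c * upper j + (- X) * lower j) + c * upper (suc s)
    ≡⟨ cong (_+ c * upper (suc s))
            (trans (sum-+ s (λ j → c * upper j) (λ j → (- X) * lower j))
                   (cong₂ _+_ (sum-* s c upper) (sum-* s (- X) lower))) ⟩
  (c * sumFrom1 s upper + (- X) * sumFrom1 s lower) + c * upper (suc s)
    ≡⟨ collect c X (sumFrom1 s upper) (sumFrom1 s lower) (upper (suc s)) ⟩
  c * (sumFrom1 s upper + upper (suc s)) - X * sumFrom1 s lower ∎
  where
  c X : ℤ
  c = + suc s
  X = + suc x
  term upper lower : ℕ → ℤ
  term  j = v j * + (suc x C (suc s ∸ j))
  upper j = u j * + (suc x C (suc s ∸ j))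
  lower j = u j * + (x C (s ∸ j))

  lastTerm : term (suc s) ≡ c * upper (suc s)
  lastTerm = trans (cong (_* + (suc x C (suc s ∸ suc s))) (v≡j*u (suc s)))
                   (ℤP.*-assoc c (u (suc s)) _)

  raiseTerm : ∀ j d (a : ℤ) → j ℕ.+ suc d ≡ suc s →
    (+ j * a) * + (suc x C suc d) ≡ c * (a * + (suc x C suc d)) + (- X) * (a * + (x C d))
  raiseTerm j d a j+d+1≡s+1 = begin
    (+ j * a) * C₁
      ≡⟨ separate (+ j) (+ suc d) a C₁ ⟩
    (+ j + + suc d) * (a * C₁) - a * (+ suc d * C₁)
      ≡⟨ cong₂ (λ p q → p * (a * C₁) - a * q)
               (trans (sym (ℤP.pos-+ j (suc d))) (cong +_ j+d+1≡s+1)) (absorptionℤ x d) ⟩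
    c * (a * C₁) - a * (X * C₀)
      ≡⟨ regroup c X a C₁ C₀ ⟩
    c * (a * C₁) + (- X) * (a * C₀) ∎
    where
    C₁ = + (suc x C suc d)
    C₀ = + (x C d)
    separate : ∀ (J B a C₁ : ℤ) → (J * a) * C₁ ≡ (J + B) * (a * C₁) - a * (B * C₁)
    separate = solve-∀
    regroup : ∀ (c X a C₁ C₀ : ℤ) → c * (a * C₁) - a * (X * C₀) ≡ c * (a * C₁) + (- X) * (a * C₀)
    regroup = solve-∀

  split : ∀ j → 1 ≤ j → j ≤ s → term j ≡ c * upper j + (- X) * lower j
  split j _ j≤s rewrite suc-∸ j≤s =
    trans (cong (_* + (suc x C suc (s ∸ j))) (v≡j*u j))
          (raiseTerm j (s ∸ j) (u j) (trans (ℕP.+-suc j (s ∸ j)) (cong suc (ℕP.m+[n∸m]≡n j≤s))))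

  collect : ∀ (c X A B L : ℤ) → (c * A + (- X) * B) + c * L ≡ c * (A + L) - X * B
  collect = solve-∀

moserWeight-raise : ∀ m j → moserWeight (suc (suc m)) j ≡ + j * moserWeight (suc m) j
moserWeight-raise m j =
  trans (cong (sgn (j ∸ 1) *_) (ℤP.pos-* j (j ℕ.^ m)))
        (commute (sgn (j ∸ 1)) (+ j) (+ (j ℕ.^ m)))
  where
  commute : ∀ (σ J P : ℤ) → σ * (J * P) ≡ J * (σ * P)
  commute = solve-∀

F-pascal : ∀ (s : ℤ) k x → F s k (suc x) ≡ F s k x + F (s - + 1) k x
F-pascal (+ zero)  k x = refl
F-pascal (+ suc s) k x = binomialSum-pascal (moserWeight k) s x
F-pascal -[1+ s ]  k x = refl

F-raise : ∀ (s : ℤ) m x →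
  F s (suc (suc m)) (suc x) ≡ s * F s (suc m) (suc x) - + suc x * F (s - + 1) (suc m) x
F-raise (+ zero)  m x rewrite ℤP.*-zeroʳ (+ suc x) = refl
F-raise (+ suc s) m x = binomialSum-raise (moserWeight-raise m) s x
F-raise -[1+ s ]  m x rewrite ℤP.*-zeroʳ (+ suc x) | ℤP.*-zeroʳ -[1+ s ] = refl

reflect-shift : ∀ (n s : ℤ) → (+ 1 + n) - s ≡ n - (s - + 1)
reflect-shift = solve-∀

reflect-pred : ∀ (n s : ℤ) → ((+ 1 + n) - s) - + 1 ≡ n - s
reflect-pred = solve-∀

F-pascal-reflected : ∀ (s : ℤ) k n →
  F (+ suc n - s) k (suc n) ≡ F (+ n - (s - + 1)) k n + F (+ n - s) k n
F-pascal-reflected s k n =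
  trans (F-pascal (+ suc n - s) k n)
        (cong₂ (λ p q → F p k n + F q k n) (reflect-shift (+ n) s) (reflect-pred (+ n) s))

-- For k = 1 and x = 1 the last two terms cancel: F_{s,1}(1) = 0 for s ≥ 2.
F-weight1-at-1 : ∀ s → Fℕ (suc (suc s)) 1 1 ≡ 0ℤ
F-weight1-at-1 s = begin
  Fℕ (suc (suc s)) 1 1
    ≡⟨ binomialSum-pascal (moserWeight 1) (suc s) 0 ⟩
  binomialSum (moserWeight 1) (suc (suc s)) 0 + binomialSum (moserWeight 1) (suc s) 0
    ≡⟨ cong₂ _+_ (binomialSum-at-0 (moserWeight 1) (suc s)) (binomialSum-at-0 (moserWeight 1) s) ⟩
  (- sgn s) * + 1 + sgn s * + 1
    ≡⟨ cancel (sgn s) ⟩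
  0ℤ ∎
  where
  cancel : ∀ (σ : ℤ) → (- σ) * + 1 + σ * + 1 ≡ 0ℤ
  cancel = solve-∀

defect : ℕ → ℤ → ℕ → ℤ
defect k s n = F s k n - sgn k * F (+ n - s) k n

defect-pascal : ∀ k (s : ℤ) n → defect k s (suc n) ≡ defect k s n + defect k (s - + 1) n
defect-pascal k s n = begin
  F s k (suc n) - sgn k * F (+ suc n - s) k (suc n)
    ≡⟨ cong₂ (λ p q → p - sgn k * q) (F-pascal s k n) (F-pascal-reflected s k n) ⟩
  (F s k n + F (s - + 1) k n) - sgn k * (F (+ n - (s - + 1)) k n + F (+ n - s) k n)
    ≡⟨ regroup (sgn k) (F s k n) (F (s - + 1) k n) (F (+ n - (s - + 1)) k n) (F (+ n - s) k n) ⟩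
  defect k s n + defect k (s - + 1) n ∎
  where
  regroup : ∀ (σ P Q R T : ℤ) → (P + Q) - σ * (R + T) ≡ (P - σ * T) + (Q - σ * R)
  regroup = solve-∀

defect-raise : ∀ m (s : ℤ) n →
  defect (suc (suc m)) s (suc n) ≡
    s * defect (suc m) s (suc n) - + suc n * defect (suc m) (s - + 1) n
defect-raise m s n = begin
  F s (suc (suc m)) (suc n) - (- σ) * F (N - s) (suc (suc m)) (suc n)
    ≡⟨ cong₂ (λ p q → p - (- σ) * q) (F-raise s m n) reflectedRaise ⟩
  (s * a - N * b) - (- σ) * ((N - s) * (e + d) - N * d)
    ≡⟨ regroup σ s N a b e d ⟩
  s * (a - σ * (e + d)) - N * (b - σ * e)
    ≡⟨ cong (λ p → s * (a - σ * p) - N * (b - σ * e)) (sym (F-pascal-reflected s (suc m) n)) ⟩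
  s * defect (suc m) s (suc n) - N * defect (suc m) (s - + 1) n ∎
  where
  σ N a b e d : ℤ
  σ = sgn (suc m)
  N = + suc n
  a = F s (suc m) (suc n)
  b = F (s - + 1) (suc m) n
  e = F (+ n - (s - + 1)) (suc m) n
  d = F (+ n - s) (suc m) n
  reflectedRaise : F (N - s) (suc (suc m)) (suc n) ≡ (N - s) * (e + d) - N * d
  reflectedRaise =
    trans (F-raise (N - s) m n)
          (cong₂ (λ p q → (N - s) * p - N * F q (suc m) n)
                 (F-pascal-reflected s (suc m) n) (reflect-pred (+ n) s))
  regroup : ∀ (σ s N a b e d : ℤ) →
    (s * a - N * b) - (- σ) * ((N - s) * (e + d) - N * d) ≡ s * (a - σ * (e + d)) - N * (b - σ * e)
  regroup = solve-∀

-- E_1(s, n) = C(n, s) for n ≥ 1: check n = 1 directly, then both sides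
-- satisfy the Pascal recurrence.

defect1-at-1 : ∀ s → defect 1 s 1 ≡ binomℤ 1 s
defect1-at-1 (+ zero)          = refl
defect1-at-1 (+ suc zero)      = refl
defect1-at-1 (+ suc (suc s))   rewrite F-weight1-at-1 s = refl
defect1-at-1 -[1+ s ]          rewrite F-weight1-at-1 s = refl

defect1 : ∀ n s → defect 1 s (suc n) ≡ binomℤ (suc n) s
defect1 zero    s = defect1-at-1 s
defect1 (suc n) s = begin
  defect 1 s (suc (suc n))
    ≡⟨ defect-pascal 1 s (suc n) ⟩
  defect 1 s (suc n) + defect 1 (s - + 1) (suc n)
    ≡⟨ cong₂ _+_ (defect1 n s) (defect1 n (s - + 1)) ⟩
  binomℤ (suc n) s + binomℤ (suc n) (s - + 1)
    ≡⟨ sym (binomℤ-pascal (suc n) s) ⟩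
  binomℤ (suc (suc n)) s ∎

-- E_2(s, n) = 0 for n ≥ 2: the raise recurrence turns E_1 = C(n, s) into the
-- absorption identity.
defect2 : ∀ n s → defect 2 s (suc (suc n)) ≡ 0ℤ
defect2 n s = begin
  defect 2 s (suc (suc n))
    ≡⟨ defect-raise 0 s (suc n) ⟩
  s * defect 1 s (suc (suc n)) - N * defect 1 (s - + 1) (suc n)
    ≡⟨ cong₂ (λ p q → s * p - N * q) (defect1 (suc n) s) (defect1 n (s - + 1)) ⟩
  s * binomℤ (suc (suc n)) s - N * binomℤ (suc n) (s - + 1)
    ≡⟨ cong (_- N * binomℤ (suc n) (s - + 1)) (binomℤ-absorption (suc n) s) ⟩
  N * binomℤ (suc n) (s - + 1) - N * binomℤ (suc n) (s - + 1)
    ≡⟨ ℤP.+-inverseʳ (N * binomℤ (suc n) (s - + 1)) ⟩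
  0ℤ ∎
  where
  N = + suc (suc n)

defect-vanishes : ∀ m (s : ℤ) n → suc (suc m) ≤ n → defect (suc (suc m)) s n ≡ 0ℤ
defect-vanishes zero    s (suc (suc n)) _ = defect2 n s
defect-vanishes zero    s (suc zero) (s≤s ())
defect-vanishes (suc m) s (suc n) (s≤s 3+m≤1+n) = begin
  defect (suc (suc (suc m))) s (suc n)
    ≡⟨ defect-raise (suc m) s n ⟩
  s * defect (suc (suc m)) s (suc n) - + suc n * defect (suc (suc m)) (s - + 1) n
    ≡⟨ cong₂ (λ p q → s * p - + suc n * q)
             (defect-vanishes m s (suc n) (ℕP.m≤n⇒m≤1+n 3+m≤1+n))
             (defect-vanishes m (s - + 1) n 3+m≤1+n) ⟩
  s * 0ℤ - + suc n * 0ℤ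
    ≡⟨ annihilate s (+ suc n) ⟩
  0ℤ ∎
  where
  annihilate : ∀ (s N : ℤ) → s * 0ℤ - N * 0ℤ ≡ 0ℤ
  annihilate = solve-∀

proposition3p6 : ∀ (s k n : ℕ) → 1 < k → k ≤ n →
    F (+ s) k n ≡ sgn k * F (+ n - + s) k n
proposition3p6 s (suc zero)    n (s≤s ()) _
proposition3p6 s (suc (suc m)) n _ k≤n =
  ℤP.i-j≡0⇒i≡j _ _ (defect-vanishes m (+ s) n k≤n)
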